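{- A graph $G$ on $n$ vertices satisfies $\Gamma_{\rho}(G)=n$ if and only if $G$ has a universal vertex.
   Context: Graphs are finite and simple; $d(u,v)$ is the distance in $G$ (infinite between different components). A universal vertex is one adjacent to all other vertices. A packing coloring $c:V(G)\to\{1,\dots,k\}$ satisfies: $c(u)=c(v)=i$, $u\ne v$, implies $d(u,v)>i$. The Grundy packing chromatic number $\Gamma_{\rho}(G)$ is the maximum number of colors $k$ in a packing coloring $c:V(G)\to\{1,\dots,k\}$ using all $k$ colors in which every vertex $v$ with $c(v)=i$ has, for every $j\in\{1,\dots,i-1\}$, a vertex $u$ with $c(u)=j$ and $d(u,v)\le j$ (equivalently, the maximum number of colors produced by the greedy procedure that processes vertices in some order and assigns each vertex the smallest color $i$ with no already-colored vertex of color $i$ at distance at most $i$). -}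

module Defs where

open import Data.Nat using (ℕ; zero; suc; _≤_; _<_)
open import Data.Fin using (Fin)
open import Data.Product using (Σ; ∃; _×_)
open import Relation.Nullary using (¬_; Dec)
open import Relation.Binary.PropositionalEquality using (_≡_; _≢_)

record Graph (n : ℕ) : Set₁ where
  field
    Adj     : Fin n → Fin n → Set
    adj-sym : ∀ {u v} → Adj u v → Adj v u
    adj-irr : ∀ {u} → ¬ Adj u u
    adj-dec : ∀ u v → Dec (Adj u v)
open Graph public

-- WithinDist G i u v  :  d(u,v) ≤ i  (there is a walk of length ≤ i from u to v).
-- For vertices in different components this never holds (d = ∞).
data WithinDist {n : ℕ} (G : Graph n) : ℕ → Fin n → Fin n → Set where
  here : ∀ {i u} → WithinDist G i u u
  step : ∀ {i u w v} → Adj G u w → WithinDist G i w v → WithinDist G (suc i) u v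

record PackingColoring {n : ℕ} (G : Graph n) (k : ℕ) (c : Fin n → ℕ) : Set where
  field
    range   : ∀ v → 1 ≤ c v × c v ≤ k
    onto    : ∀ i → 1 ≤ i → i ≤ k → ∃ λ v → c v ≡ i
    packing : ∀ u v → u ≢ v → c u ≡ c v → ¬ WithinDist G (c u) u v

record GrundyPackingColoring {n : ℕ} (G : Graph n) (k : ℕ) (c : Fin n → ℕ) : Set where
  field
    isPacking : PackingColoring G k c
    grundy    : ∀ v j → 1 ≤ j → j < c v → ∃ λ u → c u ≡ j × WithinDist G j u v

GrundyPackingNumberIs : {n : ℕ} → Graph n → ℕ → Set
GrundyPackingNumberIs {n} G m =
  (∃ λ (c : Fin n → ℕ) → GrundyPackingColoring G m c)
  × (∀ k (c : Fin n → ℕ) → GrundyPackingColoring G k c → k ≤ m)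

HasUniversalVertex : {n : ℕ} → Graph n → Set
HasUniversalVertex {n} G = ∃ λ (v : Fin n) → ∀ u → u ≢ v → Adj G v u

{-# OPTIONS --safe #-}
-- With n colours on n vertices every colour class is a single vertex, since otherwise the
-- n colours would fit on n − 1 vertices. The Grundy condition for colour 1 then puts the
-- unique vertex of colour 1 within distance 1 of every other vertex. Conversely, a
-- universal vertex makes the diameter at most 2, so giving it colour 1 and the other
-- vertices the distinct colours 2, …, n yields a Grundy packing colouring.
module Submission where

open import Defs
open import Data.Nat using (ℕ; zero; suc; _≤_; _<_; z≤n; s≤s)
open import Data.Nat.Properties using (suc-injective; 1+n≰n; ≤∧≢⇒<; ≤-trans; <⇒≤)
open import Data.Fin using (Fin; toℕ; fromℕ<) renaming (zero to 0F)
open import Data.Fin.Properties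
  using (_≟_; toℕ<n; toℕ-injective; toℕ-fromℕ<; punchOut-injective; injective⇒≤)
open import Data.Fin.Permutation using (Permutation′; _⟨$⟩ʳ_; _⟨$⟩ˡ_; inverseʳ; transpose)
open import Data.Product using (∃; _×_; _,_; proj₁; proj₂)
open import Data.Empty using (⊥-elim)
open import Function.Base using (_∘_)
open import Function.Bundles using (_⇔_; mk⇔; Injection)
open import Function.Properties.Inverse using (↔⇒↣)
open import Function.Definitions using (Injective)
open import Relation.Nullary using (yes; no)
open import Relation.Nullary.Decidable using (dec-true)
open import Relation.Binary.PropositionalEquality
  using (_≡_; _≢_; refl; sym; trans; cong; subst; module ≡-Reasoning)

CoversColours : ∀ {N} → (Fin N → ℕ) → ℕ → Set
CoversColours c k = ∀ i → 1 ≤ i → i ≤ k → ∃ λ v → c v ≡ i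

colourIndexed⇒injective : ∀ {k N} (c : Fin N → ℕ) {f : Fin k → Fin N} →
                          (∀ a → c (f a) ≡ suc (toℕ a)) → Injective _≡_ _≡_ f
colourIndexed⇒injective c {f} cf {a} {b} fa≡fb =
  toℕ-injective (suc-injective (begin
    suc (toℕ a) ≡⟨ sym (cf a) ⟩
    c (f a)     ≡⟨ cong c fa≡fb ⟩
    c (f b)     ≡⟨ cf b ⟩
    suc (toℕ b) ∎))
  where open ≡-Reasoning

module _ {N k} {c : Fin N → ℕ} (covers : CoversColours c k) where

  representative : Fin k → Fin N
  representative a = proj₁ (covers (suc (toℕ a)) (s≤s z≤n) (toℕ<n a))

  colour-representative : ∀ a → c (representative a) ≡ suc (toℕ a)
  colour-representative a = proj₂ (covers (suc (toℕ a)) (s≤s z≤n) (toℕ<n a))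

  covers⇒≤ : k ≤ N
  covers⇒≤ = injective⇒≤ (colourIndexed⇒injective c colour-representative)

-- Choosing representatives that avoid w (taking u in its place) embeds the k colours
-- into the other m vertices.
repeatedColour⇒≤ : ∀ {m k} {c : Fin (suc m) → ℕ} → CoversColours c k →
                   ∀ {u w} → u ≢ w → c u ≡ c w → k ≤ m
repeatedColour⇒≤ {m} {k} {c} covers {u} {w} u≢w cu≡cw =
  injective⇒≤ (λ {a} {b} → colourIndexed⇒injective c colour-avoiding
                  ∘ punchOut-injective (avoids-w a) (avoids-w b))
  where
  avoiding : Fin k → Fin (suc m)
  avoiding a with representative covers a ≟ w
  ... | yes _ = u
  ... | no _ = representative covers a

  colour-avoiding : ∀ a → c (avoiding a) ≡ suc (toℕ a)
  colour-avoiding a with representative covers a ≟ w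
  ... | yes r≡w = trans cu≡cw (subst (λ x → c x ≡ suc (toℕ a)) r≡w (colour-representative covers a))
  ... | no _ = colour-representative covers a

  avoids-w : ∀ a → w ≢ avoiding a
  avoids-w a with representative covers a ≟ w
  ... | yes _ = u≢w ∘ sym
  ... | no r≢w = r≢w ∘ sym

covers⇒injective : ∀ {m} {c : Fin (suc m) → ℕ} → CoversColours c (suc m) → Injective _≡_ _≡_ c
covers⇒injective covers {u} {w} cu≡cw with u ≟ w
... | yes u≡w = u≡w
... | no u≢w = ⊥-elim (1+n≰n (repeatedColour⇒≤ covers u≢w cu≡cw))

within1⇒adj : ∀ {N} {G : Graph N} {u v} → WithinDist G 1 u v → u ≢ v → Adj G u v
within1⇒adj here u≢u = ⊥-elim (u≢u refl)
within1⇒adj (step uv here) _ = uv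

uniqueColour1⇒universal : ∀ {N k} {G : Graph N} {c} → GrundyPackingColoring G k c →
                          ∀ {v} → (∀ u → c u ≡ 1 → u ≡ v) → ∀ u → u ≢ v → Adj G v u
uniqueColour1⇒universal {G = G} {c} gc {v} unique u u≢v =
  let w , cw≡1 , w-near-u = grundy u 1 (s≤s z≤n) 1<cu in
  within1⇒adj (subst (λ x → WithinDist G 1 x u) (unique w cw≡1) w-near-u) (u≢v ∘ sym)
  where
  open GrundyPackingColoring gc
  open PackingColoring isPacking

  1<cu : 1 < c u
  1<cu = ≤∧≢⇒< (proj₁ (range u)) (u≢v ∘ unique u ∘ sym)

injective⇒packing : ∀ {N k} {G : Graph N} {c : Fin N → ℕ} → Injective _≡_ _≡_ c →
                    (∀ x → 1 ≤ c x × c x ≤ k) → CoversColours c k → PackingColoring G k c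
injective⇒packing injective range covers = record
  { range   = range
  ; onto    = covers
  ; packing = λ u w u≢w cu≡cw _ → u≢w (injective cu≡cw)
  }

module _ {N} {G : Graph N} {v} (universal : ∀ u → u ≢ v → Adj G v u) where

  universal-near : ∀ {i} x → WithinDist G (suc i) v x
  universal-near x with x ≟ v
  ... | yes refl = here
  ... | no x≢v = step (universal x x≢v) here

  diameter≤2 : ∀ {i} u x → WithinDist G (suc (suc i)) u x
  diameter≤2 u x with u ≟ v
  ... | yes refl = universal-near x
  ... | no u≢v = step (adj-sym G (universal u u≢v)) (universal-near x)

  injective⇒grundy : ∀ {k} {c : Fin N → ℕ} → Injective _≡_ _≡_ c →
                     (∀ x → 1 ≤ c x × c x ≤ k) → CoversColours c k → c v ≡ 1 →
                     GrundyPackingColoring G k c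
  injective⇒grundy {c = c} injective range covers cv≡1 = record
    { isPacking = injective⇒packing injective range covers
    ; grundy    = near
    }
    where
    near : ∀ x j → 1 ≤ j → j < c x → ∃ λ u → c u ≡ j × WithinDist G j u x
    near x (suc zero) _ _ = v , cv≡1 , universal-near x
    near x (suc (suc j)) 1≤j j<cx =
      let u , cu≡j = covers (suc (suc j)) 1≤j (≤-trans (<⇒≤ j<cx) (proj₂ (range x))) in
      u , cu≡j , diameter≤2 u x

module _ {N} (π : Permutation′ N) where

  rank : Fin N → ℕ
  rank x = suc (toℕ (π ⟨$⟩ʳ x))

  rank-injective : Injective _≡_ _≡_ rank
  rank-injective = Injection.injective (↔⇒↣ π) ∘ toℕ-injective ∘ suc-injective

  rank-range : ∀ x → 1 ≤ rank x × rank x ≤ N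
  rank-range x = s≤s z≤n , toℕ<n (π ⟨$⟩ʳ x)

  rank-covers : CoversColours rank N
  rank-covers (suc i) _ i<N =
    π ⟨$⟩ˡ fromℕ< i<N , cong suc (trans (cong toℕ (inverseʳ π)) (toℕ-fromℕ< i<N))

transpose-first : ∀ {N} (i j : Fin N) → transpose i j ⟨$⟩ʳ i ≡ j
transpose-first i j rewrite dec-true (i ≟ i) refl = refl

proposition7 : (n : ℕ) (G : Graph (suc n)) →
    GrundyPackingNumberIs G (suc n) ⇔ HasUniversalVertex G
proposition7 n G = mk⇔ grundyPackingNumber⇒universal universal⇒grundyPackingNumber
  where
  grundyPackingNumber⇒universal : GrundyPackingNumberIs G (suc n) → HasUniversalVertex G
  grundyPackingNumber⇒universal ((c , gc) , _) =
    let v , cv≡1 = onto 1 (s≤s z≤n) (s≤s z≤n) in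
    v , uniqueColour1⇒universal gc (λ u cu≡1 → covers⇒injective onto (trans cu≡1 (sym cv≡1)))
    where open PackingColoring (GrundyPackingColoring.isPacking gc)

  universal⇒grundyPackingNumber : HasUniversalVertex G → GrundyPackingNumberIs G (suc n)
  universal⇒grundyPackingNumber (v , universal) =
    (rank π , injective⇒grundy universal (rank-injective π) (rank-range π) (rank-covers π)
                                (cong (suc ∘ toℕ) (transpose-first v 0F)))
    , λ k c gc → covers⇒≤ (PackingColoring.onto (GrundyPackingColoring.isPacking gc))
    where
    π : Permutation′ (suc n)
    π = transpose v 0F
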